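{- Let $u$ be a power of $2$ and let $P$ be a set of $n$ points on the $u \times u$ integer grid. Suppose $P$ can be covered by $c$ clusters $C_1,\dots,C_c \subseteq P$ (so $P = C_1 \cup \dots \cup C_c$, the clusters not necessarily disjoint), where cluster $C_i$ has $n_i$ points and diameter $\ell_i$. Then the quadtree of $P$ has $O\!\left(c \log u + \sum_{i=1}^{c} n_i \log \ell_i\right)$ nodes.
   Context: The quadtree of a point set $P$ on a $u\times u$ grid ($u$ a power of $2$) is defined recursively: if the grid contains $0$ points of $P$ (resp. all $u^2$ of its cells belong to $P$), the quadtree is a single root node storing $0$ (resp. $1$); otherwise the root stores $1$ and has four children, which are the quadtrees of the four $(u/2)\times(u/2)$ quadrants of the grid (in the order top-left, top-right, bottom-left, bottom-right) with respect to the points of $P$ lying in them. The quadtree has height at most $\lg u$, and a node at depth $d$ corresponds to an aligned $2^{\lg u - d}\times 2^{\lg u-d}$ square of the grid. -}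

module Defs where

open import Data.Nat using (ℕ; zero; suc; _+_; _*_; _^_; _<?_; _⊔_; ∣_-_∣)
open import Data.Nat.Logarithm using (⌊log₂_⌋)
open import Data.Fin using (Fin; fromℕ<)
open import Data.Bool using (Bool; true; false; if_then_else_; not)
open import Data.List using (List; map; upTo; cartesianProduct; filter; length; foldr; concatMap; allFin)
open import Data.Nat.ListAction using (sum)
open import Data.Bool using (_∧_; _≟_)
open import Data.Product using (_×_; _,_)
open import Relation.Nullary using (yes; no)
open import Relation.Nullary.Decidable using (does)

-- A point set on the u × u grid with u = 2 ^ k, as a Boolean membership function.
PointSet : ℕ → Set
PointSet k = Fin (2 ^ k) → Fin (2 ^ k) → Bool

-- Membership read off on natural-number coordinates (false outside the grid).
mem : (k : ℕ) → PointSet k → ℕ → ℕ → Bool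
mem k S x y with x <? 2 ^ k | y <? 2 ^ k
... | yes p | yes q = S (fromℕ< p) (fromℕ< q)
... | _     | _     = false

square : ℕ → ℕ → ℕ → List (ℕ × ℕ)
square x0 y0 s = cartesianProduct (map (x0 +_) (upTo s)) (map (y0 +_) (upTo s))

-- Quadtrees: a leaf stores a bit, an internal node stores 1 and has 4 children
-- (top-left, top-right, bottom-left, bottom-right).
data QuadTree : Set where
  leaf : Bool → QuadTree
  node : QuadTree → QuadTree → QuadTree → QuadTree → QuadTree

nodes : QuadTree → ℕ
nodes (leaf _)       = 1
nodes (node a b c d) = suc (nodes a + nodes b + nodes c + nodes d)

all : {A : Set} → (A → Bool) → List A → Bool
all t = foldr (λ a b → t a ∧ b) true

cell : (ℕ → ℕ → Bool) → ℕ × ℕ → Bool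
cell f (x , y) = f x y

-- quadtree of the 2^d × 2^d square with corner (x0 , y0) w.r.t. membership f
-- (x = column, y = row counted from the top)
build : ℕ → ℕ → ℕ → (ℕ → ℕ → Bool) → QuadTree
build d x0 y0 f =
  if all (λ p → not (cell f p)) (square x0 y0 (2 ^ d)) then leaf false
  else if all (cell f) (square x0 y0 (2 ^ d)) then leaf true
  else split d
  where
    split : ℕ → QuadTree
    split zero    = leaf true   -- unreachable: a 1×1 square is empty or full
    split (suc e) = node (build e x0 y0 f) (build e (x0 + h) y0 f)
                         (build e x0 (y0 + h) f) (build e (x0 + h) (y0 + h) f)
      where h = 2 ^ e

quadtree : (k : ℕ) → PointSet k → QuadTree
quadtree k P = build k 0 0 (mem k P)

points : (k : ℕ) → PointSet k → List (ℕ × ℕ)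
points k S = filter (λ p → cell (mem k S) p ≟ true) (square 0 0 (2 ^ k))

card : (k : ℕ) → PointSet k → ℕ
card k S = length (points k S)

dist : ℕ × ℕ → ℕ × ℕ → ℕ
dist (a , b) (c , d) = ∣ a - c ∣ ⊔ ∣ b - d ∣

-- diameter (0 for sets with at most one point)
diam : (k : ℕ) → PointSet k → ℕ
diam k S = foldr _⊔_ 0 (concatMap (λ p → map (dist p) (points k S)) (points k S))

Σ[<_]_ : (c : ℕ) → (Fin c → ℕ) → ℕ
Σ[< c ] f = sum (map f (allFin c))

-- A quadtree with m internal nodes has 4m + 1 nodes, and every internal node is an
-- occupied aligned square of side 2^j ≥ 2.  The aligned squares of one level are
-- disjoint, so at level j their number is at most the length of any list of cells
-- meeting every occupied square.  A cluster of diameter ℓ ≤ 2^j is met by the nine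
-- aligned corners around one of its points; at the at most log ℓ levels with
-- 2^j < ℓ we use its n points themselves.  Summing over the k levels and the c
-- clusters gives 9ck + Σ nᵢ log ℓᵢ.
module Submission where

open import Defs
open import Algebra.Properties.CommutativeSemigroup using (interchange)
open import Data.Bool using (Bool; true; false; not; if_then_else_; _≟_)
open import Data.Bool.Properties using (not-involutive)
open import Data.Fin using (Fin)
open import Data.List using (List; []; _∷_; map; upTo; cartesianProduct; concatMap; foldr; allFin; length)
open import Data.List.Membership.Propositional using (_∈_)
open import Data.List.Membership.Propositional.Properties
  using ( ∈-map⁺; ∈-map⁻; ∈-upTo⁺; ∈-upTo⁻; ∈-cartesianProduct⁺; ∈-cartesianProduct⁻
        ; ∈-filter⁺; ∈-concatMap⁺; ∈-allFin)
open import Data.List.Properties using (length-++; length-tabulate; map-cong)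
open import Data.List.Relation.Unary.Any using (here; there) renaming (map to any-map)
open import Data.Nat
  using (ℕ; zero; suc; _+_; _*_; _∸_; _^_; _⊔_; _⊓_; _≤_; _<_; z≤n; s≤s; _≤?_; _<?_; NonZero; ∣_-_∣)
open import Data.Nat.DivMod using (_/_; m*n/n≡m; /-monoˡ-≤; m/n≡1+[m∸n]/n; m<n*o⇒m/o<n)
open import Data.Nat.Divisibility using (_∣_; divides; ∣-refl; ∣-trans; n∣m*n; ∣m∣n⇒∣m+n)
open import Data.Nat.ListAction using (sum)
open import Data.Nat.Logarithm using (⌊log₂_⌋; ⌊log₂⌋-mono-≤; ⌊log₂[2^n]⌋≡n)
open import Data.Nat.Properties hiding (_≟_)
open import Data.Nat.Tactic.RingSolver using (solve-∀)
open import Data.Product using (∃-syntax; _×_; _,_; proj₁; proj₂)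
open import Function using (_∘_; id)
open import Relation.Binary.PropositionalEquality
open import Relation.Nullary using (Dec; yes; no; contradiction)

module _ {A : Set} where

  sum-map-mono : (f g : A → ℕ) → (∀ x → f x ≤ g x) → ∀ xs → sum (map f xs) ≤ sum (map g xs)
  sum-map-mono f g f≤g []       = z≤n
  sum-map-mono f g f≤g (x ∷ xs) = +-mono-≤ (f≤g x) (sum-map-mono f g f≤g xs)

  sum-map≤length : (f : A → ℕ) → (∀ x → f x ≤ 1) → ∀ xs → sum (map f xs) ≤ length xs
  sum-map≤length f f≤1 []       = z≤n
  sum-map≤length f f≤1 (x ∷ xs) = +-mono-≤ (f≤1 x) (sum-map≤length f f≤1 xs)

  sum-map-∈ : (f : A → ℕ) {x : A} {xs : List A} → x ∈ xs → f x ≤ sum (map f xs)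
  sum-map-∈ f {xs = y ∷ xs} (here refl) = m≤m+n (f y) _
  sum-map-∈ f {xs = y ∷ xs} (there x∈xs) = ≤-trans (sum-map-∈ f x∈xs) (m≤n+m _ (f y))

  sum-map-const : ∀ n (xs : List A) → sum (map (λ _ → n) xs) ≡ length xs * n
  sum-map-const n []       = refl
  sum-map-const n (x ∷ xs) = cong (n +_) (sum-map-const n xs)

  sum-map-+ : (f g : A → ℕ) → ∀ xs → sum (map (λ x → f x + g x) xs) ≡ sum (map f xs) + sum (map g xs)
  sum-map-+ f g []       = refl
  sum-map-+ f g (x ∷ xs) = trans (cong (f x + g x +_) (sum-map-+ f g xs))
                                 (interchange +-commutativeSemigroup (f x) (g x) _ _)

  sum-map-+₄ : (f a b c d : A → ℕ) → (∀ x → f x ≡ a x + b x + c x + d x) → ∀ xs →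
               sum (map f xs) ≡ sum (map a xs) + sum (map b xs) + sum (map c xs) + sum (map d xs)
  sum-map-+₄ f a b c d f≡ xs = begin
    sum (map f xs)                                          ≡⟨ cong sum (map-cong f≡ xs) ⟩
    sum (map (λ x → a x + b x + c x + d x) xs)              ≡⟨ sum-map-+ _ d xs ⟩
    sum (map (λ x → a x + b x + c x) xs) + sum (map d xs)   ≡⟨ cong (_+ sum (map d xs)) (sum-map-+ _ c xs) ⟩
    sum (map (λ x → a x + b x) xs) + sum (map c xs) + sum (map d xs)
      ≡⟨ cong (λ s → s + sum (map c xs) + sum (map d xs)) (sum-map-+ a b xs) ⟩
    sum (map a xs) + sum (map b xs) + sum (map c xs) + sum (map d xs) ∎
    where open ≡-Reasoning

  sum-map-comm : {B : Set} (h : A → B → ℕ) (xs : List A) (ys : List B) →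
                 sum (map (λ y → sum (map (λ x → h x y) xs)) ys) ≡ sum (map (λ x → sum (map (h x) ys)) xs)
  sum-map-comm h xs []       = sym (trans (sum-map-const 0 xs) (*-zeroʳ (length xs)))
  sum-map-comm h xs (y ∷ ys) = trans (cong (_ +_) (sum-map-comm h xs ys))
                                     (sym (sum-map-+ (λ x → h x y) (λ x → sum (map (h x) ys)) xs))

  length-concatMap : {B : Set} (g : A → List B) (xs : List A) →
                     length (concatMap g xs) ≡ sum (map (length ∘ g) xs)
  length-concatMap g []       = refl
  length-concatMap g (x ∷ xs) = trans (length-++ (g x)) (cong (length (g x) +_) (length-concatMap g xs))

  all≡false⇒∃ : (t : A → Bool) (xs : List A) → all t xs ≡ false → ∃[ x ] (x ∈ xs × t x ≡ false)
  all≡false⇒∃ t (x ∷ xs) all≡false with t x in tx≡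
  ... | false = x , here refl , tx≡
  ... | true  = let y , y∈xs , ty≡ = all≡false⇒∃ t xs all≡false in y , there y∈xs , ty≡

∈⇒≤foldr-⊔ : ∀ {v} xs → v ∈ xs → v ≤ foldr _⊔_ 0 xs
∈⇒≤foldr-⊔ (x ∷ xs) (here refl)  = m≤m⊔n x _
∈⇒≤foldr-⊔ (x ∷ xs) (there v∈xs) = ≤-trans (∈⇒≤foldr-⊔ xs v∈xs) (m≤n⊔m x _)

mem⇒< : ∀ k (S : PointSet k) x y → mem k S x y ≡ true → x < 2 ^ k × y < 2 ^ k
mem⇒< k S x y Sxy with x <? 2 ^ k | y <? 2 ^ k
... | yes x< | yes y< = x< , y<

mem⇒∈points : ∀ k (S : PointSet k) x y → mem k S x y ≡ true → (x , y) ∈ points k S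
mem⇒∈points k S x y Sxy =
  ∈-filter⁺ (λ p → cell (mem k S) p ≟ true)
    (∈-cartesianProduct⁺ (∈-map⁺ (0 +_) (∈-upTo⁺ x<)) (∈-map⁺ (0 +_) (∈-upTo⁺ y<))) Sxy
  where x< = proj₁ (mem⇒< k S x y Sxy)
        y< = proj₂ (mem⇒< k S x y Sxy)

mem-cover : ∀ k (P : PointSet k) c (C : Fin c → PointSet k) →
            (∀ x y → P x y ≡ true → ∃[ i ] (C i x y ≡ true)) →
            ∀ x y → mem k P x y ≡ true → ∃[ i ] (mem k (C i) x y ≡ true)
mem-cover k P c C covers x y Pxy with x <? 2 ^ k | y <? 2 ^ k
... | yes _ | yes _ = covers _ _ Pxy

dist≤diam : ∀ k (S : PointSet k) {p q} → p ∈ points k S → q ∈ points k S → dist p q ≤ diam k S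
dist≤diam k S {p} {q} p∈S q∈S =
  ∈⇒≤foldr-⊔ _ (∈-concatMap⁺ (λ p → map (dist p) (points k S))
                               (any-map (λ { refl → ∈-map⁺ (dist p) q∈S }) p∈S))

InSquare : ℕ → ℕ → ℕ → ℕ × ℕ → Set
InSquare s x0 y0 (x , y) = (x0 ≤ x × x < x0 + s) × (y0 ≤ y × y < y0 + s)

∈square⇒InSquare : ∀ s x0 y0 {p} → p ∈ square x0 y0 s → InSquare s x0 y0 p
∈square⇒InSquare s x0 y0 p∈ with ∈-cartesianProduct⁻ (map (x0 +_) (upTo s)) (map (y0 +_) (upTo s)) p∈
... | x∈ , y∈ with ∈-map⁻ (x0 +_) x∈ | ∈-map⁻ (y0 +_) y∈
... | a , a∈ , refl | b , b∈ , refl =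
  (m≤m+n x0 a , +-monoʳ-< x0 (∈-upTo⁻ a∈)) , (m≤m+n y0 b , +-monoʳ-< y0 (∈-upTo⁻ b∈))

inRange : ℕ → ℕ → ℕ → ℕ
inRange x0 s x with x0 ≤? x | x <? x0 + s
... | yes _ | yes _ = 1
... | _     | _     = 0

inRange-inside : ∀ {x0 s x} → x0 ≤ x → x < x0 + s → inRange x0 s x ≡ 1
inRange-inside {x0} {s} {x} x0≤x x< with x0 ≤? x | x <? x0 + s
... | yes _ | yes _  = refl
... | no x0≰x | _    = contradiction x0≤x x0≰x
... | yes _ | no x≮ = contradiction x< x≮

inRange-below : ∀ {x0 s x} → x < x0 → inRange x0 s x ≡ 0
inRange-below {x0} {s} {x} x<x0 with x0 ≤? x | x <? x0 + s
... | yes x0≤x | yes _ = contradiction x0≤x (<⇒≱ x<x0)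
... | no _     | _     = refl
... | yes _    | no _  = refl

inRange-above : ∀ {x0 s x} → x0 + s ≤ x → inRange x0 s x ≡ 0
inRange-above {x0} {s} {x} x0+s≤x with x0 ≤? x | x <? x0 + s
... | yes _ | yes x< = contradiction x0+s≤x (<⇒≱ x<)
... | no _  | _      = refl
... | yes _ | no _   = refl

inRange≤1 : ∀ x0 s x → inRange x0 s x ≤ 1
inRange≤1 x0 s x with x0 ≤? x | x <? x0 + s
... | yes _ | yes _ = ≤-refl
... | no _  | _     = z≤n
... | yes _ | no _  = z≤n

m+n+n≡m+2*n : ∀ m n → m + n + n ≡ m + 2 * n
m+n+n≡m+2*n = solve-∀

inRange-split : ∀ x0 h x → inRange x0 (2 * h) x ≡ inRange x0 h x + inRange (x0 + h) h x
inRange-split x0 h x = split (x <? x0) (x <? x0 + h) (x <? x0 + h + h)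
  where
  open ≡-Reasoning
  split : Dec (x < x0) → Dec (x < x0 + h) → Dec (x < x0 + h + h) →
          inRange x0 (2 * h) x ≡ inRange x0 h x + inRange (x0 + h) h x
  split (yes x<x0) _ _ = begin
    inRange x0 (2 * h) x
      ≡⟨ inRange-below x<x0 ⟩
    0 + 0
      ≡⟨ cong₂ _+_ (inRange-below {x0} {h} x<x0) (inRange-below {x0 + h} {h} x<x0+h) ⟨
    inRange x0 h x + inRange (x0 + h) h x ∎
    where x<x0+h = <-≤-trans x<x0 (m≤m+n x0 h)
  split (no x≮x0) (yes x<x0+h) _ = begin
    inRange x0 (2 * h) x
      ≡⟨ inRange-inside (≮⇒≥ x≮x0) (<-≤-trans x<x0+h x0+h≤x0+2h) ⟩
    1 + 0
      ≡⟨ cong₂ _+_ (inRange-inside {x0} {h} (≮⇒≥ x≮x0) x<x0+h) (inRange-below {x0 + h} {h} x<x0+h) ⟨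
    inRange x0 h x + inRange (x0 + h) h x ∎
    where x0+h≤x0+2h = ≤-trans (m≤m+n (x0 + h) h) (≤-reflexive (m+n+n≡m+2*n x0 h))
  split (no x≮x0) (no x≮x0+h) (yes x<x0+h+h) = begin
    inRange x0 (2 * h) x
      ≡⟨ inRange-inside (≮⇒≥ x≮x0) (subst (x <_) (m+n+n≡m+2*n x0 h) x<x0+h+h) ⟩
    0 + 1
      ≡⟨ cong₂ _+_ (inRange-above {x0} {h} (≮⇒≥ x≮x0+h))
                   (inRange-inside {x0 + h} {h} (≮⇒≥ x≮x0+h) x<x0+h+h) ⟨
    inRange x0 h x + inRange (x0 + h) h x ∎
  split (no _) (no x≮x0+h) (no x≮x0+h+h) = begin
    inRange x0 (2 * h) x
      ≡⟨ inRange-above (subst (_≤ x) (m+n+n≡m+2*n x0 h) (≮⇒≥ x≮x0+h+h)) ⟩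
    0 + 0
      ≡⟨ cong₂ _+_ (inRange-above {x0} {h} (≮⇒≥ x≮x0+h)) (inRange-above {x0 + h} {h} (≮⇒≥ x≮x0+h+h)) ⟨
    inRange x0 h x + inRange (x0 + h) h x ∎

inSquare : ℕ → ℕ → ℕ → ℕ × ℕ → ℕ
inSquare s x0 y0 (x , y) = inRange x0 s x * inRange y0 s y

inSquare-inside : ∀ s x0 y0 {p} → InSquare s x0 y0 p → inSquare s x0 y0 p ≡ 1
inSquare-inside s x0 y0 ((x0≤x , x<) , (y0≤y , y<)) = cong₂ _*_ (inRange-inside x0≤x x<) (inRange-inside y0≤y y<)

inSquare≤1 : ∀ s x0 y0 p → inSquare s x0 y0 p ≤ 1
inSquare≤1 s x0 y0 (x , y) = *-mono-≤ (inRange≤1 x0 s x) (inRange≤1 y0 s y)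

inSquare-split : ∀ h x0 y0 p → inSquare (2 * h) x0 y0 p ≡
  inSquare h x0 y0 p + inSquare h (x0 + h) y0 p + inSquare h x0 (y0 + h) p + inSquare h (x0 + h) (y0 + h) p
inSquare-split h x0 y0 (x , y) rewrite inRange-split x0 h x | inRange-split y0 h y =
  expand (inRange x0 h x) (inRange (x0 + h) h x) (inRange y0 h y) (inRange (y0 + h) h y)
  where expand : ∀ a b c d → (a + b) * (c + d) ≡ a * c + b * c + a * d + b * d
        expand = solve-∀

isEmpty : ℕ → ℕ → ℕ → (ℕ → ℕ → Bool) → Bool
isEmpty d x y f = all (λ p → not (cell f p)) (square x y (2 ^ d))

isEmpty≡false⇒∃ : ∀ d x y f → isEmpty d x y f ≡ false → ∃[ p ] (cell f p ≡ true × InSquare (2 ^ d) x y p)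
isEmpty≡false⇒∃ d x y f nonempty with all≡false⇒∃ (λ p → not (cell f p)) (square x y (2 ^ d)) nonempty
... | p , p∈ , ¬fp≡false =
  p , trans (sym (not-involutive (cell f p))) (cong not ¬fp≡false) , ∈square⇒InSquare (2 ^ d) x y p∈

-- Only squares of side ≥ 2 are counted; they include the internal nodes of build d x y f.
occupiedSquares : ℕ → ℕ → ℕ → (ℕ → ℕ → Bool) → ℕ
occupiedSquares zero    x y f = 0
occupiedSquares (suc e) x y f = if isEmpty (suc e) x y f then 0 else
  suc (occupiedSquares e x y f + occupiedSquares e (x + h) y f +
       occupiedSquares e x (y + h) f + occupiedSquares e (x + h) (y + h) f)
  where h = 2 ^ e

nodes-build≤ : ∀ d x y f → nodes (build d x y f) ≤ suc (4 * occupiedSquares d x y f)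
nodes-build≤ zero x y f with isEmpty 0 x y f | all (cell f) (square x y 1)
... | true  | _     = ≤-refl
... | false | true  = ≤-refl
... | false | false = ≤-refl
nodes-build≤ (suc e) x y f with isEmpty (suc e) x y f | all (cell f) (square x y (2 ^ suc e))
... | true  | _     = ≤-refl
... | false | true  = s≤s z≤n
... | false | false = s≤s (≤-trans
  (+-mono-≤ (+-mono-≤ (+-mono-≤ (nodes-build≤ e x y f) (nodes-build≤ e (x + h) y f))
                      (nodes-build≤ e x (y + h) f)) (nodes-build≤ e (x + h) (y + h) f))
  (≤-reflexive (four-subtrees (occ x y) (occ (x + h) y) (occ x (y + h)) (occ (x + h) (y + h)))))
  where
  h = 2 ^ e
  occ : ℕ → ℕ → ℕ
  occ x′ y′ = occupiedSquares e x′ y′ f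
  four-subtrees : ∀ a b c d → suc (4 * a) + suc (4 * b) + suc (4 * c) + suc (4 * d) ≡ 4 * suc (a + b + c + d)
  four-subtrees = solve-∀

levels : ℕ → List ℕ
levels zero    = []
levels (suc k) = suc k ∷ levels k

hits : List (ℕ × ℕ) → ℕ → ℕ → ℕ → ℕ
hits ws s x0 y0 = sum (map (inSquare s x0 y0) ws)

Witnesses : (ℕ → ℕ → Bool) → (ℕ → List (ℕ × ℕ)) → Set
Witnesses f W = ∀ j {x0 y0 p} → 2 ^ j ∣ x0 → 2 ^ j ∣ y0 → cell f p ≡ true → InSquare (2 ^ j) x0 y0 p →
                ∃[ w ] (w ∈ W j × InSquare (2 ^ j) x0 y0 w)

module _ (W : ℕ → List (ℕ × ℕ)) where

  levelHits : ℕ → ℕ → ℕ → ℕ → ℕ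
  levelHits m s x0 y0 = sum (map (λ j → hits (W j) s x0 y0) (levels m))

  levelHits-split : ∀ m h x0 y0 → levelHits m (2 * h) x0 y0 ≡
    levelHits m h x0 y0 + levelHits m h (x0 + h) y0 + levelHits m h x0 (y0 + h) + levelHits m h (x0 + h) (y0 + h)
  levelHits-split m h x0 y0 =
    sum-map-+₄ _ _ _ _ _ (λ j → sum-map-+₄ _ _ _ _ _ (inSquare-split h x0 y0) (W j)) (levels m)

  levelHits≤ : ∀ m s x0 y0 → levelHits m s x0 y0 ≤ sum (map (length ∘ W) (levels m))
  levelHits≤ m s x0 y0 = sum-map-mono _ _ (λ j → sum-map≤length _ (inSquare≤1 s x0 y0) (W j)) (levels m)

  -- Each occupied square at level j contains a witness of W j, and distinct squares
  -- of a level are disjoint, so no witness is counted twice.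
  occupiedSquares≤levelHits : ∀ {f} → Witnesses f W → ∀ d {x y} → 2 ^ d ∣ x → 2 ^ d ∣ y →
                              occupiedSquares d x y f ≤ levelHits d (2 ^ d) x y
  occupiedSquares≤levelHits wit zero _ _ = z≤n
  occupiedSquares≤levelHits {f} wit (suc e) {x} {y} ∣x ∣y with isEmpty (suc e) x y f in isEmpty≡
  ... | true  = z≤n
  ... | false = +-mono-≤ witnessed quadrants
    where
    h = 2 ^ e
    witnessed : 1 ≤ hits (W (suc e)) (2 ^ suc e) x y
    witnessed with isEmpty≡false⇒∃ (suc e) x y f isEmpty≡
    ... | p , fp , p∈□ with wit (suc e) ∣x ∣y fp p∈□
    ... | w , w∈W , w∈□ =
      subst (_≤ hits (W (suc e)) (2 ^ suc e) x y) (inSquare-inside _ x y w∈□) (sum-map-∈ _ w∈W)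
    ∣x′ : 2 ^ e ∣ x
    ∣x′ = ∣-trans (n∣m*n 2) ∣x
    ∣y′ : 2 ^ e ∣ y
    ∣y′ = ∣-trans (n∣m*n 2) ∣y
    ∣x+h : 2 ^ e ∣ x + h
    ∣x+h = ∣m∣n⇒∣m+n ∣x′ ∣-refl
    ∣y+h : 2 ^ e ∣ y + h
    ∣y+h = ∣m∣n⇒∣m+n ∣y′ ∣-refl
    quadrants : occupiedSquares e x y f + occupiedSquares e (x + h) y f +
                occupiedSquares e x (y + h) f + occupiedSquares e (x + h) (y + h) f ≤ levelHits e (2 ^ suc e) x y
    quadrants = ≤-trans
      (+-mono-≤ (+-mono-≤ (+-mono-≤ (occupiedSquares≤levelHits wit e ∣x′ ∣y′)
                                    (occupiedSquares≤levelHits wit e ∣x+h ∣y′))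
                          (occupiedSquares≤levelHits wit e ∣x′ ∣y+h))
                (occupiedSquares≤levelHits wit e ∣x+h ∣y+h))
      (≤-reflexive (sym (levelHits-split e h x y)))

occupiedSquares≤witnesses : ∀ {f W} → Witnesses f W → ∀ k →
                            occupiedSquares k 0 0 f ≤ sum (map (length ∘ W) (levels k))
occupiedSquares≤witnesses {W = W} wit k =
  ≤-trans (occupiedSquares≤levelHits W wit k (divides 0 refl) (divides 0 refl)) (levelHits≤ W k (2 ^ k) 0 0)

nearCorners : (s : ℕ) .{{_ : NonZero s}} → ℕ → List ℕ
nearCorners s a = map (λ r → (a / s ∸ 1 + r) * s) (upTo 3)

-- With x0 = α s and q = a / s, the bounds give α ≤ 1 + q and q < 2 + α,
-- so α = (q ∸ 1) + r for some r ≤ 2.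
corner∈nearCorners : ∀ s .{{_ : NonZero s}} {x0 x a} → s ∣ x0 → x0 ≤ x → x < x0 + s → ∣ x - a ∣ ≤ s →
                     x0 ∈ nearCorners s a
corner∈nearCorners s {x = x} {a} (divides α refl) αs≤x x<αs+s ∣x-a∣≤s =
  subst (λ z → z * s ∈ nearCorners s a) (m+[n∸m]≡n q∸1≤α)
        (∈-map⁺ (λ r → (q ∸ 1 + r) * s) (∈-upTo⁺ (s≤s r≤2)))
  where
  q = a / s
  α≤1+q : α ≤ 1 + q
  α≤1+q = begin
    α                   ≡⟨ m*n/n≡m α s ⟨
    α * s / s           ≤⟨ /-monoˡ-≤ s (≤-trans αs≤x (≤-trans (m≤n+∣m-n∣ x a) (+-monoʳ-≤ a ∣x-a∣≤s))) ⟩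
    (a + s) / s         ≡⟨ m/n≡1+[m∸n]/n (m≤n+m s a) ⟩
    1 + (a + s ∸ s) / s ≡⟨ cong (λ z → 1 + z / s) (m+n∸n≡m a s) ⟩
    1 + q               ∎
    where open ≤-Reasoning
  q<2+α : q < 2 + α
  q<2+α = m<n*o⇒m/o<n (begin-strict
    a               ≤⟨ ≤-trans (m≤n+∣n-m∣ a x) (+-monoʳ-≤ x ∣x-a∣≤s) ⟩
    x + s           <⟨ +-monoˡ-< s x<αs+s ⟩
    α * s + s + s   ≡⟨ +-comm (α * s + s) s ⟩
    s + (α * s + s) ≡⟨ cong (s +_) (+-comm (α * s) s) ⟩
    (2 + α) * s     ∎)
    where open ≤-Reasoning
  q∸1≤α : q ∸ 1 ≤ α
  q∸1≤α = m≤n+o⇒m∸n≤o q 1 (≤-pred q<2+α)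
  r≤2 : α ∸ (q ∸ 1) ≤ 2
  r≤2 = m≤n+o⇒m∸n≤o α (q ∸ 1)
          (≤-trans α≤1+q (≤-trans (+-monoʳ-≤ 1 (m≤n+m∸n q 1)) (≤-reflexive (+-comm 2 (q ∸ 1)))))

nearbyCorners : ℕ → List (ℕ × ℕ) → List (ℕ × ℕ)
nearbyCorners j []            = []
nearbyCorners j ((a , b) ∷ _) =
  cartesianProduct (nearCorners (2 ^ j) {{m^n≢0 2 j}} a) (nearCorners (2 ^ j) {{m^n≢0 2 j}} b)

length-nearbyCorners : ∀ j ps → length (nearbyCorners j ps) ≤ 9
length-nearbyCorners j []      = z≤n
length-nearbyCorners j (_ ∷ _) = ≤-refl

corner∈nearbyCorners : ∀ j {x0 y0 x y a b ps} → 2 ^ j ∣ x0 → 2 ^ j ∣ y0 → InSquare (2 ^ j) x0 y0 (x , y) →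
                       dist (x , y) (a , b) ≤ 2 ^ j → (x0 , y0) ∈ nearbyCorners j ((a , b) ∷ ps)
corner∈nearbyCorners j ∣x0 ∣y0 ((x0≤x , x<) , (y0≤y , y<)) dist≤ = ∈-cartesianProduct⁺
  (corner∈nearCorners (2 ^ j) {{m^n≢0 2 j}} ∣x0 x0≤x x< (≤-trans (m≤m⊔n _ _) dist≤))
  (corner∈nearCorners (2 ^ j) {{m^n≢0 2 j}} ∣y0 y0≤y y< (≤-trans (m≤n⊔m _ _) dist≤))

witnessesAt : ℕ → List (ℕ × ℕ) → ℕ → List (ℕ × ℕ)
witnessesAt ℓ ps j with ℓ ≤? 2 ^ j
... | yes _ = nearbyCorners j ps
... | no  _ = ps

witnessBound : ℕ → ℕ → ℕ → ℕ
witnessBound ℓ n j with ℓ ≤? 2 ^ j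
... | yes _ = 9
... | no  _ = n

length-witnessesAt : ∀ ℓ ps j → length (witnessesAt ℓ ps j) ≤ witnessBound ℓ (length ps) j
length-witnessesAt ℓ ps j with ℓ ≤? 2 ^ j
... | yes _ = length-nearbyCorners j ps
... | no  _ = ≤-refl

witnessesAt-cover : ∀ ℓ ps j {x0 y0 p} → (∀ {q r} → q ∈ ps → r ∈ ps → dist q r ≤ ℓ) →
                    2 ^ j ∣ x0 → 2 ^ j ∣ y0 → p ∈ ps → InSquare (2 ^ j) x0 y0 p →
                    ∃[ w ] (w ∈ witnessesAt ℓ ps j × InSquare (2 ^ j) x0 y0 w)
witnessesAt-cover ℓ [] j _ _ _ () _
witnessesAt-cover ℓ ((a , b) ∷ ps) j {x0} {y0} {x , y} diam≤ℓ ∣x0 ∣y0 p∈ps p∈□ with ℓ ≤? 2 ^ j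
... | no  _      = (x , y) , p∈ps , p∈□
... | yes ℓ≤2^j  = (x0 , y0) ,
                   corner∈nearbyCorners j {ps = ps} ∣x0 ∣y0 p∈□ (≤-trans (diam≤ℓ p∈ps (here refl)) ℓ≤2^j) ,
                   ((≤-refl , m<m+n x0 (m^n>0 2 j)) , (≤-refl , m<m+n y0 (m^n>0 2 j)))

2^n<m⇒n≤⌊log₂m⌋ : ∀ {m n} → 2 ^ n < m → n ≤ ⌊log₂ m ⌋
2^n<m⇒n≤⌊log₂m⌋ {m} {n} 2^n<m = subst (_≤ ⌊log₂ m ⌋) (⌊log₂[2^n]⌋≡n n) (⌊log₂⌋-mono-≤ (<⇒≤ 2^n<m))

sum-witnessBound : ∀ ℓ n k → sum (map (witnessBound ℓ n) (levels k)) ≤ 9 * k + n * (k ⊓ ⌊log₂ ℓ ⌋)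
sum-witnessBound ℓ n zero = z≤n
sum-witnessBound ℓ n (suc k) with ℓ ≤? 2 ^ suc k
... | yes _ = begin
  9 + sum (map (witnessBound ℓ n) (levels k)) ≤⟨ +-monoʳ-≤ 9 (sum-witnessBound ℓ n k) ⟩
  9 + (9 * k + n * (k ⊓ L))                   ≡⟨ +-assoc 9 (9 * k) (n * (k ⊓ L)) ⟨
  9 + 9 * k + n * (k ⊓ L)                     ≡⟨ cong (_+ n * (k ⊓ L)) (*-suc 9 k) ⟨
  9 * suc k + n * (k ⊓ L)                     ≤⟨ +-monoʳ-≤ (9 * suc k) (*-monoʳ-≤ n (⊓-monoˡ-≤ L (n≤1+n k))) ⟩
  9 * suc k + n * (suc k ⊓ L)                 ∎
  where open ≤-Reasoning
        L = ⌊log₂ ℓ ⌋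
... | no ℓ≰2^[1+k] = begin
  n + sum (map (witnessBound ℓ n) (levels k)) ≤⟨ +-monoʳ-≤ n (sum-witnessBound ℓ n k) ⟩
  n + (9 * k + n * (k ⊓ L))                   ≡⟨ cong (λ z → n + (9 * k + n * z)) (m≤n⇒m⊓n≡m (<⇒≤ 1+k≤L)) ⟩
  n + (9 * k + n * k)                         ≡⟨ rearrange n k ⟩
  9 * k + n * suc k                           ≤⟨ +-monoˡ-≤ (n * suc k) (*-monoʳ-≤ 9 (n≤1+n k)) ⟩
  9 * suc k + n * suc k                       ≡⟨ cong (λ z → 9 * suc k + n * z) (m≤n⇒m⊓n≡m 1+k≤L) ⟨
  9 * suc k + n * (suc k ⊓ L)                 ∎
  where open ≤-Reasoning
        L = ⌊log₂ ℓ ⌋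
        1+k≤L : suc k ≤ L
        1+k≤L = 2^n<m⇒n≤⌊log₂m⌋ (≰⇒> ℓ≰2^[1+k])
        rearrange : ∀ n k → n + (9 * k + n * k) ≡ 9 * k + n * suc k
        rearrange = solve-∀

clusterWitnesses : ∀ k c → (Fin c → PointSet k) → ℕ → List (ℕ × ℕ)
clusterWitnesses k c C j = concatMap (λ i → witnessesAt (diam k (C i)) (points k (C i)) j) (allFin c)

clusterWitnesses-witness : ∀ k (P : PointSet k) c (C : Fin c → PointSet k) →
                           (∀ x y → P x y ≡ true → ∃[ i ] (C i x y ≡ true)) →
                           Witnesses (mem k P) (clusterWitnesses k c C)
clusterWitnesses-witness k P c C covers j {p = x , y} ∣x0 ∣y0 Pxy p∈□ with mem-cover k P c C covers x y Pxy
... | i , Cixy with witnessesAt-cover (diam k (C i)) (points k (C i)) j (dist≤diam k (C i)) ∣x0 ∣y0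
                                      (mem⇒∈points k (C i) x y Cixy) p∈□
... | w , w∈ , w∈□ = w , ∈-concatMap⁺ _ (any-map (λ { refl → w∈ }) (∈-allFin i)) , w∈□

occupiedSquares≤clusterCost : ∀ k (P : PointSet k) c (C : Fin c → PointSet k) →
  (∀ x y → P x y ≡ true → ∃[ i ] (C i x y ≡ true)) →
  occupiedSquares k 0 0 (mem k P) ≤ c * (9 * k) + Σ[< c ] (λ i → card k (C i) * ⌊log₂ (diam k (C i)) ⌋)
occupiedSquares≤clusterCost k P c C covers = begin
  occupiedSquares k 0 0 (mem k P)
    ≤⟨ occupiedSquares≤witnesses (clusterWitnesses-witness k P c C covers) k ⟩
  sum (map (length ∘ clusterWitnesses k c C) (levels k))
    ≡⟨ cong sum (map-cong (λ j → length-concatMap (W j) (allFin c)) (levels k)) ⟩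
  sum (map (λ j → sum (map (λ i → length (W j i)) (allFin c))) (levels k))
    ≤⟨ sum-map-mono _ _ (λ j → sum-map-mono _ _ (λ i → length-witnessesAt (ℓ i) (points k (C i)) j) (allFin c))
                    (levels k) ⟩
  sum (map (λ j → sum (map (λ i → witnessBound (ℓ i) (n i) j) (allFin c))) (levels k))
    ≡⟨ sum-map-comm (λ i → witnessBound (ℓ i) (n i)) (allFin c) (levels k) ⟩
  sum (map (λ i → sum (map (witnessBound (ℓ i) (n i)) (levels k))) (allFin c))
    ≤⟨ sum-map-mono _ _ (λ i → ≤-trans (sum-witnessBound (ℓ i) (n i) k)
                                       (+-monoʳ-≤ (9 * k) (*-monoʳ-≤ (n i) (m⊓n≤n k _)))) (allFin c) ⟩
  sum (map (λ i → 9 * k + n i * ⌊log₂ (ℓ i) ⌋) (allFin c))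
    ≡⟨ sum-map-+ (λ _ → 9 * k) (λ i → n i * ⌊log₂ (ℓ i) ⌋) (allFin c) ⟩
  sum (map (λ _ → 9 * k) (allFin c)) + Σ[< c ] (λ i → n i * ⌊log₂ (ℓ i) ⌋)
    ≡⟨ cong (_+ Σ[< c ] (λ i → n i * ⌊log₂ (ℓ i) ⌋))
            (trans (sum-map-const (9 * k) (allFin c)) (cong (_* (9 * k)) (length-tabulate {n = c} id))) ⟩
  c * (9 * k) + Σ[< c ] (λ i → n i * ⌊log₂ (ℓ i) ⌋) ∎
  where
  open ≤-Reasoning
  ℓ n : Fin c → ℕ
  ℓ i = diam k (C i)
  n i = card k (C i)
  W : ℕ → Fin c → List (ℕ × ℕ)
  W j i = witnessesAt (ℓ i) (points k (C i)) j

-- The bound only needs the clusters to cover P, so the hypothesis C i ⊆ P is unused.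
theorem1 : ∃[ K ] ((k : ℕ) (P : PointSet k) (c : ℕ) (C : Fin c → PointSet k)
    → (∀ i x y → C i x y ≡ true → P x y ≡ true)
    → (∀ x y → P x y ≡ true → ∃[ i ] (C i x y ≡ true))
    → nodes (quadtree k P)
    ≤ K * (1 + c * k + Σ[< c ] (λ i → card k (C i) * ⌊log₂ (diam k (C i)) ⌋)))
theorem1 = 36 , λ k P c C _ covers →
  ≤-trans (nodes-build≤ k 0 0 (mem k P))
 (≤-trans (s≤s (*-monoʳ-≤ 4 (occupiedSquares≤clusterCost k P c C covers)))
          (absorb-constants c k _))
  where
  absorb-constants : ∀ c k S → suc (4 * (c * (9 * k) + S)) ≤ 36 * (1 + c * k + S)
  absorb-constants c k S = ≤-trans (m≤m+n _ (35 + 32 * S)) (≤-reflexive (expand c k S))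
    where expand : ∀ c k S → suc (4 * (c * (9 * k) + S)) + (35 + 32 * S) ≡ 36 * (1 + c * k + S)
          expand = solve-∀
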